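{- For every natural number $k$ and every formula $\varphi$: (1) if $\mathrm{PNF}(\varphi) \cap \Sigma_k^+ \neq \emptyset$, then $\varphi \in \mathrm{E}_k^+$; (2) if $\mathrm{PNF}(\varphi) \cap \Pi_k^+ \neq \emptyset$, then $\varphi \in \mathrm{U}_k^+$.
   Context: Fix an arbitrary first-order language whose logical symbols are $\forall, \exists, \to, \land, \lor, \perp$. $\mathrm{FV}(\varphi)$ is the set of free variables of $\varphi$. Prenex classes: $\Sigma_0 = \Pi_0$ is the class of quantifier-free formulas; $\Sigma_{k+1}$ is the class of formulas $\exists x_1 \cdots \exists x_n \varphi$ with $n \geq 1$ and $\varphi \in \Pi_k$; $\Pi_{k+1}$ is the class of formulas $\forall x_1 \cdots \forall x_n \varphi$ with $n\ge 1$ and $\varphi \in \Sigma_k$. $\Sigma_k^+ = \Sigma_k \cup \bigcup_{i<k}(\Sigma_i \cup \Pi_i)$, $\Pi_k^+ = \Pi_k \cup \bigcup_{i<k}(\Sigma_i \cup \Pi_i)$. A formula is in prenex normal form if it is in $\Sigma_k \cup \Pi_k$ for some $k$. Alternation paths: finite sequences of $+$ and $-$ in which $+$ and $-$ alternate. For such $s$, $i(s)$ is its first symbol if $s$ is nonempty and a special symbol $\times$ if $s=\langle\,\rangle$; $s^\perp$ swaps $+$ and $-$; $l(s)$ is its length; $+s$, $-s$ denote prepending. $\mathrm{Alt}(\varphi)$: if $\varphi$ is quantifier-free, $\{\langle\,\rangle\}$; otherwise $\mathrm{Alt}(\varphi_1 \land \varphi_2)=\mathrm{Alt}(\varphi_1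 \lor \varphi_2) = \mathrm{Alt}(\varphi_1)\cup\mathrm{Alt}(\varphi_2)$; $\mathrm{Alt}(\varphi_1\to\varphi_2) = \{s^\perp : s\in\mathrm{Alt}(\varphi_1)\}\cup\mathrm{Alt}(\varphi_2)$; $\mathrm{Alt}(\forall x\varphi_1) = \{s\in\mathrm{Alt}(\varphi_1): i(s)=-\}\cup\{ -s: s\in\mathrm{Alt}(\varphi_1), i(s)\neq -\}$; $\mathrm{Alt}(\exists x\varphi_1) = \{s\in\mathrm{Alt}(\varphi_1): i(s)=+\}\cup\{+s: s\in\mathrm{Alt}(\varphi_1), i(s)\neq +\}$. $\deg(\varphi)=\max\{l(s): s\in\mathrm{Alt}(\varphi)\}$. Classes: $\mathrm{F}_k=\{\varphi:\deg(\varphi)=k\}$; $\mathrm{U}_0=\mathrm{E}_0=\mathrm{F}_0$; $\mathrm{U}_{k+1}=\{\varphi\in\mathrm{F}_{k+1}: i(s)=- \text{ for all } s\in\mathrm{Alt}(\varphi) \text{ with } l(s)=k+1\}$; $\mathrm{E}_{k+1}$ likewise with $+$; $\mathrm{U}_k^+=\mathrm{U}_k\cup\bigcup_{i<k}\mathrm{F}_i$; $\mathrm{E}_k^+=\mathrm{E}_k\cup\bigcup_{i<k}\mathrm{F}_i$. Prenex transformation: $\varphi\rhd\psi$ means that for some formulas $\xi,\delta$, a variable $x\notin\mathrm{FV}(\delta)$, a variable $y$ not occurring in $\xi$, and $Q\in\{\forall,\exists\}$, $(\varphi,\psi)$ is one of: $(\exists x\xi(x)\to\delta, \forall x(\xi(x)\to\delta))$;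 $(\forall x\xi(x)\to\delta, \exists x(\xi(x)\to\delta))$; $(\delta\to Qx\,\xi(x), Qx(\delta\to\xi(x)))$; $(Qx\,\xi(x)\land\delta, Qx(\xi(x)\land\delta))$; $(\delta\land Qx\,\xi(x), Qx(\delta\land\xi(x)))$; $(Qx\,\xi(x)\lor\delta, Qx(\xi(x)\lor\delta))$; $(\delta\lor Qx\,\xi(x), Qx(\delta\lor\xi(x)))$; $(Qx\,\xi(x), Qy\,\xi(y))$, with $\xi(y)$ the substitution of $y$ for free $x$. $\varphi\rhd^*\psi$ means there are $m\ge0$ and $\varphi_0\equiv\varphi,\dots,\varphi_m\equiv\psi$ with each $\varphi_{i+1}$ obtained from $\varphi_i$ by replacing one occurrence of a subformula $\xi_i$ with $\delta_i$ where $\xi_i\rhd\delta_i$. $\mathrm{PNF}(\varphi)=\{\psi:\varphi\rhd^*\psi \text{ and } \psi \text{ is in prenex normal form}\}$. -}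

module Defs where

open import Data.Nat using (ℕ; zero; suc; _<_; _⊔_; _≟_)
open import Data.List using (List; []; _∷_; _++_; map; length; foldr)
open import Data.List.Membership.Propositional using (_∈_)
open import Data.Vec using (Vec; []; _∷_)
open import Data.Maybe using (Maybe; just; nothing)
open import Data.Product using (Σ; ∃; _×_; _,_)
open import Data.Sum using (_⊎_)
open import Relation.Nullary using (¬_; yes; no)
open import Relation.Binary.PropositionalEquality using (_≡_; _≢_)
open import Relation.Binary.Construct.Closure.ReflexiveTransitive using (Star)

-- An arbitrary first-order language (without built-in equality):
-- function symbols (constants = arity 0) and relation symbols with arities.
record Language : Set₁ where
  field
    Func   : Set
    farity : Func → ℕ
    Rel    : Set
    rarity : Rel → ℕ

data Quant : Set where
  all ex : Quant

data Sign : Set where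
  plus minus : Sign

flipSign : Sign → Sign
flipSign plus  = minus
flipSign minus = plus

_^⊥ : List Sign → List Sign
s ^⊥ = map flipSign s

-- i(s): first symbol, `nothing` plays the role of the special symbol ×
i : List Sign → Maybe Sign
i []      = nothing
i (a ∷ _) = just a

prefixSign : Sign → List Sign → List Sign
prefixSign plus  []            = plus ∷ []
prefixSign plus  (plus ∷ s)    = plus ∷ s
prefixSign plus  (minus ∷ s)   = plus ∷ minus ∷ s
prefixSign minus []            = minus ∷ []
prefixSign minus (minus ∷ s)   = minus ∷ s
prefixSign minus (plus ∷ s)    = minus ∷ plus ∷ s

module FOL (L : Language) where
  open Language L

  data Term : Set where
    var : ℕ → Term
    fn  : (f : Func) → Vec Term (farity f) → Term

  mutual
    data OccT (x : ℕ) : Term → Set where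
      here : OccT x (var x)
      fn   : ∀ {f ts} → OccTs x ts → OccT x (fn f ts)

    data OccTs (x : ℕ) : ∀ {n} → Vec Term n → Set where
      hd : ∀ {n t} {ts : Vec Term n} → OccT x t → OccTs x (t ∷ ts)
      tl : ∀ {n t} {ts : Vec Term n} → OccTs x ts → OccTs x (t ∷ ts)

  mutual
    substT : ℕ → ℕ → Term → Term
    substT x y (var z) with z ≟ x
    ... | yes _ = var y
    ... | no  _ = var z
    substT x y (fn f ts) = fn f (substTs x y ts)

    substTs : ∀ {n} → ℕ → ℕ → Vec Term n → Vec Term n
    substTs x y []       = []
    substTs x y (t ∷ ts) = substT x y t ∷ substTs x y ts

  infixr 5 _⇒_
  infixr 6 _∧'_ _∨'_
  data Formula : Set where
    rel  : (r : Rel) → Vec Term (rarity r) → Formula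
    ⊥'   : Formula
    _⇒_  : Formula → Formula → Formula
    _∧'_ : Formula → Formula → Formula
    _∨'_ : Formula → Formula → Formula
    qu   : Quant → ℕ → Formula → Formula

  data Free (x : ℕ) : Formula → Set where
    rel  : ∀ {r ts} → OccTs x ts → Free x (rel r ts)
    ⇒ˡ   : ∀ {φ ψ} → Free x φ → Free x (φ ⇒ ψ)
    ⇒ʳ   : ∀ {φ ψ} → Free x ψ → Free x (φ ⇒ ψ)
    ∧ˡ   : ∀ {φ ψ} → Free x φ → Free x (φ ∧' ψ)
    ∧ʳ   : ∀ {φ ψ} → Free x ψ → Free x (φ ∧' ψ)
    ∨ˡ   : ∀ {φ ψ} → Free x φ → Free x (φ ∨' ψ)
    ∨ʳ   : ∀ {φ ψ} → Free x ψ → Free x (φ ∨' ψ)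
    qu   : ∀ {Q y φ} → x ≢ y → Free x φ → Free x (qu Q y φ)

  data Occurs (x : ℕ) : Formula → Set where
    rel  : ∀ {r ts} → OccTs x ts → Occurs x (rel r ts)
    ⇒ˡ   : ∀ {φ ψ} → Occurs x φ → Occurs x (φ ⇒ ψ)
    ⇒ʳ   : ∀ {φ ψ} → Occurs x ψ → Occurs x (φ ⇒ ψ)
    ∧ˡ   : ∀ {φ ψ} → Occurs x φ → Occurs x (φ ∧' ψ)
    ∧ʳ   : ∀ {φ ψ} → Occurs x ψ → Occurs x (φ ∧' ψ)
    ∨ˡ   : ∀ {φ ψ} → Occurs x φ → Occurs x (φ ∨' ψ)
    ∨ʳ   : ∀ {φ ψ} → Occurs x ψ → Occurs x (φ ∨' ψ)
    binder : ∀ {Q φ} → Occurs x (qu Q x φ)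
    qu   : ∀ {Q y φ} → Occurs x φ → Occurs x (qu Q y φ)

  subst : ℕ → ℕ → Formula → Formula
  subst x y (rel r ts) = rel r (substTs x y ts)
  subst x y ⊥'         = ⊥'
  subst x y (φ ⇒ ψ)    = subst x y φ ⇒ subst x y ψ
  subst x y (φ ∧' ψ)   = subst x y φ ∧' subst x y ψ
  subst x y (φ ∨' ψ)   = subst x y φ ∨' subst x y ψ
  subst x y (qu Q z φ) with z ≟ x
  ... | yes _ = qu Q z φ
  ... | no  _ = qu Q z (subst x y φ)

  data _▷_ : Formula → Formula → Set where
    ex⇒   : ∀ {x ξ δ} → ¬ Free x δ → (qu ex x ξ ⇒ δ) ▷ qu all x (ξ ⇒ δ)
    all⇒  : ∀ {x ξ δ} → ¬ Free x δ → (qu all x ξ ⇒ δ) ▷ qu ex x (ξ ⇒ δ)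
    ⇒Q    : ∀ {Q x ξ δ} → ¬ Free x δ → (δ ⇒ qu Q x ξ) ▷ qu Q x (δ ⇒ ξ)
    Q∧    : ∀ {Q x ξ δ} → ¬ Free x δ → (qu Q x ξ ∧' δ) ▷ qu Q x (ξ ∧' δ)
    ∧Q    : ∀ {Q x ξ δ} → ¬ Free x δ → (δ ∧' qu Q x ξ) ▷ qu Q x (δ ∧' ξ)
    Q∨    : ∀ {Q x ξ δ} → ¬ Free x δ → (qu Q x ξ ∨' δ) ▷ qu Q x (ξ ∨' δ)
    ∨Q    : ∀ {Q x ξ δ} → ¬ Free x δ → (δ ∨' qu Q x ξ) ▷ qu Q x (δ ∨' ξ)
    rename : ∀ {Q x y ξ} → ¬ Occurs y ξ → qu Q x ξ ▷ qu Q y (subst x y ξ)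

  data _⟶_ : Formula → Formula → Set where
    root : ∀ {φ ψ} → φ ▷ ψ → φ ⟶ ψ
    ⇒ˡ   : ∀ {φ φ' ψ} → φ ⟶ φ' → (φ ⇒ ψ) ⟶ (φ' ⇒ ψ)
    ⇒ʳ   : ∀ {φ ψ ψ'} → ψ ⟶ ψ' → (φ ⇒ ψ) ⟶ (φ ⇒ ψ')
    ∧ˡ   : ∀ {φ φ' ψ} → φ ⟶ φ' → (φ ∧' ψ) ⟶ (φ' ∧' ψ)
    ∧ʳ   : ∀ {φ ψ ψ'} → ψ ⟶ ψ' → (φ ∧' ψ) ⟶ (φ ∧' ψ')
    ∨ˡ   : ∀ {φ φ' ψ} → φ ⟶ φ' → (φ ∨' ψ) ⟶ (φ' ∨' ψ)
    ∨ʳ   : ∀ {φ ψ ψ'} → ψ ⟶ ψ' → (φ ∨' ψ) ⟶ (φ ∨' ψ')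
    qu   : ∀ {Q x φ φ'} → φ ⟶ φ' → qu Q x φ ⟶ qu Q x φ'

  _▷*_ : Formula → Formula → Set
  _▷*_ = Star _⟶_

  data QF : Formula → Set where
    rel : ∀ {r ts} → QF (rel r ts)
    ⊥'  : QF ⊥'
    ⇒   : ∀ {φ ψ} → QF φ → QF ψ → QF (φ ⇒ ψ)
    ∧   : ∀ {φ ψ} → QF φ → QF ψ → QF (φ ∧' ψ)
    ∨   : ∀ {φ ψ} → QF φ → QF ψ → QF (φ ∨' ψ)

  quants : Quant → List ℕ → Formula → Formula
  quants Q []       φ = φ
  quants Q (x ∷ xs) φ = qu Q x (quants Q xs φ)

  mutual
    Σₖ : ℕ → Formula → Set
    Σₖ zero    φ = QF φ
    Σₖ (suc k) φ = Σ (List ℕ) λ xs → Σ Formula λ ψ →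
                     (xs ≢ []) × (φ ≡ quants ex xs ψ) × Πₖ k ψ

    Πₖ : ℕ → Formula → Set
    Πₖ zero    φ = QF φ
    Πₖ (suc k) φ = Σ (List ℕ) λ xs → Σ Formula λ ψ →
                     (xs ≢ []) × (φ ≡ quants all xs ψ) × Σₖ k ψ

  Σ⁺ : ℕ → Formula → Set
  Σ⁺ k φ = Σₖ k φ ⊎ (∃ λ j → j < k × (Σₖ j φ ⊎ Πₖ j φ))

  Π⁺ : ℕ → Formula → Set
  Π⁺ k φ = Πₖ k φ ⊎ (∃ λ j → j < k × (Σₖ j φ ⊎ Πₖ j φ))

  Prenex : Formula → Set
  Prenex φ = ∃ λ k → Σₖ k φ ⊎ Πₖ k φ

  _∈PNF_ : Formula → Formula → Set
  ψ ∈PNF φ = (φ ▷* ψ) × Prenex ψ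

  -- Alternation paths (finite set represented as a list)
  Alt : Formula → List (List Sign)
  Alt (rel r ts) = [] ∷ []
  Alt ⊥'         = [] ∷ []
  Alt (φ ⇒ ψ)    = map _^⊥ (Alt φ) ++ Alt ψ
  Alt (φ ∧' ψ)   = Alt φ ++ Alt ψ
  Alt (φ ∨' ψ)   = Alt φ ++ Alt ψ
  Alt (qu all x φ) = map (prefixSign minus) (Alt φ)
  Alt (qu ex  x φ) = map (prefixSign plus)  (Alt φ)

  deg : Formula → ℕ
  deg φ = foldr _⊔_ 0 (map length (Alt φ))

  F : ℕ → Formula → Set
  F k φ = deg φ ≡ k

  U : ℕ → Formula → Set
  U zero    φ = F zero φ
  U (suc k) φ = F (suc k) φ × (∀ s → s ∈ Alt φ → length s ≡ suc k → i s ≡ just minus)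

  E : ℕ → Formula → Set
  E zero    φ = F zero φ
  E (suc k) φ = F (suc k) φ × (∀ s → s ∈ Alt φ → length s ≡ suc k → i s ≡ just plus)

  U⁺ : ℕ → Formula → Set
  U⁺ k φ = U k φ ⊎ (∃ λ j → j < k × F j φ)

  E⁺ : ℕ → Formula → Set
  E⁺ k φ = E k φ ⊎ (∃ λ j → j < k × F j φ)

-- Give every formula φ a Σ-rank and a Π-rank (rank plus φ, rank minus φ): the
-- level of the Σ- resp. Π-hierarchy its quantifier structure calls for.  On a
-- quantifier block the rank of the block's own polarity is at least 1 and that
-- of the other polarity one larger.  A prenex step moves a block outwards past a
-- formula δ; since the two ranks of δ differ by at most one, the block then
-- still accounts for δ, so both ranks can only grow along ▷*.  A formula in
-- Σ⁺ k (Π⁺ k) has Σ-rank (Π-rank) at most k.  Conversely the σ-rank of φ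
-- dominates, for each alternation path s of φ, the length of s plus one unless
-- s starts with σ; so σ-rank at most k forces deg φ ≤ k, with every path of
-- length k starting with σ.
module Submission where

open import Defs
open import Data.Nat using (ℕ; zero; suc; _≤_; _⊔_; z≤n; s≤s; _≟_)
open import Data.Nat.Properties
open import Data.List using (List; []; _∷_; _++_; map; length)
open import Data.List.Properties using (length-map; foldr-preservesᵇ)
open import Data.List.Membership.Propositional using (_∈_)
open import Data.List.Membership.Propositional.Properties using (∈-++⁻; ∈-map⁻)
open import Data.List.Relation.Unary.All using (tabulate)
open import Data.List.Relation.Unary.All.Properties using (map⁺)
open import Data.List.Relation.Unary.Any using (here)
open import Data.Maybe using (just)
open import Data.Product using (∃; _×_; _,_)
open import Data.Sum using (inj₁; inj₂)
open import Data.Empty using (⊥-elim)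
open import Relation.Nullary using (yes; no)
open import Relation.Binary.PropositionalEquality using (_≡_; refl; sym; cong; cong₂)
open import Relation.Binary.Construct.Closure.ReflexiveTransitive using (fold)

sign : Quant → Sign
sign all = minus
sign ex  = plus

-- The σ-rank of a formula headed by a τ-block whose body has τ-rank r.
headed : Sign → Sign → ℕ → ℕ
headed plus  plus  r = r ⊔ 1
headed minus minus r = r ⊔ 1
headed plus  minus r = suc (r ⊔ 1)
headed minus plus  r = suc (r ⊔ 1)

headed-self : ∀ τ r → headed τ τ r ≡ r ⊔ 1
headed-self plus  r = refl
headed-self minus r = refl

headed-flip : ∀ σ τ r → headed (flipSign σ) (flipSign τ) r ≡ headed σ τ r
headed-flip plus  plus  r = refl
headed-flip plus  minus r = refl
headed-flip minus plus  r = refl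
headed-flip minus minus r = refl

headed-flipˡ : ∀ σ τ r → headed σ τ r ≤ suc (headed (flipSign σ) τ r)
headed-flipˡ plus  plus  r = ≤-trans (n≤1+n _) (n≤1+n _)
headed-flipˡ plus  minus r = ≤-refl
headed-flipˡ minus plus  r = ≤-refl
headed-flipˡ minus minus r = ≤-trans (n≤1+n _) (n≤1+n _)

headed-mono : ∀ σ τ {r r'} → r ≤ r' → headed σ τ r ≤ headed σ τ r'
headed-mono plus  plus  p = ⊔-monoˡ-≤ 1 p
headed-mono minus minus p = ⊔-monoˡ-≤ 1 p
headed-mono plus  minus p = s≤s (⊔-monoˡ-≤ 1 p)
headed-mono minus plus  p = s≤s (⊔-monoˡ-≤ 1 p)

headed-pullˡ : ∀ σ τ {a b c} → b ≤ headed σ τ c → headed σ τ a ⊔ b ≤ headed σ τ (a ⊔ c)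
headed-pullˡ σ τ {a} {c = c} p =
  ⊔-lub (headed-mono σ τ (m≤m⊔n a c)) (≤-trans p (headed-mono σ τ (m≤n⊔m a c)))

headed-pullʳ : ∀ σ τ {a b c} → b ≤ headed σ τ c → b ⊔ headed σ τ a ≤ headed σ τ (c ⊔ a)
headed-pullʳ σ τ {a} {c = c} p =
  ⊔-lub (≤-trans p (headed-mono σ τ (m≤m⊔n c a))) (headed-mono σ τ (m≤n⊔m c a))

-- pathRank σ s is the σ-rank of a prenex formula whose only alternation path is s.
pathRank : Sign → List Sign → ℕ
pathRank σ     []          = 0
pathRank plus  (plus  ∷ s) = suc (length s)
pathRank minus (minus ∷ s) = suc (length s)
pathRank plus  (minus ∷ s) = suc (suc (length s))
pathRank minus (plus  ∷ s) = suc (suc (length s))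

length≤pathRank : ∀ σ s → length s ≤ pathRank σ s
length≤pathRank σ     []          = z≤n
length≤pathRank plus  (plus  ∷ s) = ≤-refl
length≤pathRank minus (minus ∷ s) = ≤-refl
length≤pathRank plus  (minus ∷ s) = n≤1+n _
length≤pathRank minus (plus  ∷ s) = n≤1+n _

pathRank≤length⇒head : ∀ σ τ s → pathRank σ (τ ∷ s) ≤ length (τ ∷ s) → τ ≡ σ
pathRank≤length⇒head plus  plus  s p = refl
pathRank≤length⇒head minus minus s p = refl
pathRank≤length⇒head plus  minus s p = ⊥-elim (<-irrefl refl p)
pathRank≤length⇒head minus plus  s p = ⊥-elim (<-irrefl refl p)

pathRank-^⊥ : ∀ σ s → pathRank σ (s ^⊥) ≡ pathRank (flipSign σ) s
pathRank-^⊥ σ     []          = refl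
pathRank-^⊥ plus  (plus  ∷ s) = cong (λ n → suc (suc n)) (length-map flipSign s)
pathRank-^⊥ minus (minus ∷ s) = cong (λ n → suc (suc n)) (length-map flipSign s)
pathRank-^⊥ plus  (minus ∷ s) = cong suc (length-map flipSign s)
pathRank-^⊥ minus (plus  ∷ s) = cong suc (length-map flipSign s)

pathRank-prefixSign : ∀ σ τ s → pathRank σ (prefixSign τ s) ≤ headed σ τ (pathRank τ s)
pathRank-prefixSign plus  plus  []          = ≤-refl
pathRank-prefixSign plus  plus  (plus  ∷ s) = m≤m⊔n _ 1
pathRank-prefixSign plus  plus  (minus ∷ s) = m≤m⊔n _ 1
pathRank-prefixSign minus minus []          = ≤-refl
pathRank-prefixSign minus minus (minus ∷ s) = m≤m⊔n _ 1
pathRank-prefixSign minus minus (plus  ∷ s) = m≤m⊔n _ 1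
pathRank-prefixSign plus  minus []          = ≤-refl
pathRank-prefixSign plus  minus (minus ∷ s) = s≤s (m≤m⊔n _ 1)
pathRank-prefixSign plus  minus (plus  ∷ s) = s≤s (m≤m⊔n _ 1)
pathRank-prefixSign minus plus  []          = ≤-refl
pathRank-prefixSign minus plus  (plus  ∷ s) = s≤s (m≤m⊔n _ 1)
pathRank-prefixSign minus plus  (minus ∷ s) = s≤s (m≤m⊔n _ 1)

PathRanks≤ : Sign → List (List Sign) → ℕ → Set
PathRanks≤ σ A r = ∀ {s} → s ∈ A → pathRank σ s ≤ r

pathRanks≤-++ : ∀ σ {A B a b} → PathRanks≤ σ A a → PathRanks≤ σ B b →
                PathRanks≤ σ (A ++ B) (a ⊔ b)
pathRanks≤-++ σ {A} {a = a} {b} hA hB s∈ with ∈-++⁻ A s∈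
... | inj₁ s∈A = ≤-trans (hA s∈A) (m≤m⊔n a b)
... | inj₂ s∈B = ≤-trans (hB s∈B) (m≤n⊔m a b)

pathRanks≤-^⊥ : ∀ σ {A a} → PathRanks≤ (flipSign σ) A a → PathRanks≤ σ (map _^⊥ A) a
pathRanks≤-^⊥ σ hA s∈ with ∈-map⁻ _^⊥ s∈
... | t , t∈A , refl = ≤-trans (≤-reflexive (pathRank-^⊥ σ t)) (hA t∈A)

pathRanks≤-prefixSign : ∀ σ τ {A a} → PathRanks≤ τ A a →
                        PathRanks≤ σ (map (prefixSign τ) A) (headed σ τ a)
pathRanks≤-prefixSign σ τ hA s∈ with ∈-map⁻ (prefixSign τ) s∈
... | t , t∈A , refl = ≤-trans (pathRank-prefixSign σ τ t) (headed-mono σ τ (hA t∈A))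

module Rank (L : Language) where
  open FOL L

  rank : Sign → Formula → ℕ
  rank σ (rel r ts) = 0
  rank σ ⊥'         = 0
  rank σ (φ ⇒ ψ)    = rank (flipSign σ) φ ⊔ rank σ ψ
  rank σ (φ ∧' ψ)   = rank σ φ ⊔ rank σ ψ
  rank σ (φ ∨' ψ)   = rank σ φ ⊔ rank σ ψ
  rank σ (qu Q x φ) = headed σ (sign Q) (rank (sign Q) φ)

  rank-flip : ∀ σ φ → rank σ φ ≤ suc (rank (flipSign σ) φ)
  rank-flip σ     (rel r ts) = z≤n
  rank-flip σ     ⊥'         = z≤n
  rank-flip plus  (φ ⇒ ψ)    = ⊔-mono-≤ (rank-flip minus φ) (rank-flip plus ψ)
  rank-flip minus (φ ⇒ ψ)    = ⊔-mono-≤ (rank-flip plus φ) (rank-flip minus ψ)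
  rank-flip σ     (φ ∧' ψ)   = ⊔-mono-≤ (rank-flip σ φ) (rank-flip σ ψ)
  rank-flip σ     (φ ∨' ψ)   = ⊔-mono-≤ (rank-flip σ φ) (rank-flip σ ψ)
  rank-flip σ     (qu Q x φ) = headed-flipˡ σ (sign Q) _

  rank≤headed : ∀ σ τ φ → rank σ φ ≤ headed σ τ (rank τ φ)
  rank≤headed plus  plus  φ = m≤m⊔n _ 1
  rank≤headed minus minus φ = m≤m⊔n _ 1
  rank≤headed plus  minus φ = ≤-trans (rank-flip plus φ) (s≤s (m≤m⊔n _ 1))
  rank≤headed minus plus  φ = ≤-trans (rank-flip minus φ) (s≤s (m≤m⊔n _ 1))

  rank-flip≤headed : ∀ σ τ φ → rank (flipSign σ) φ ≤ headed σ τ (rank (flipSign τ) φ)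
  rank-flip≤headed σ τ φ =
    ≤-trans (rank≤headed (flipSign σ) (flipSign τ) φ) (≤-reflexive (headed-flip σ τ _))

  rank-subst : ∀ σ x y φ → rank σ (subst x y φ) ≡ rank σ φ
  rank-subst σ x y (rel r ts) = refl
  rank-subst σ x y ⊥'         = refl
  rank-subst σ x y (φ ⇒ ψ)    = cong₂ _⊔_ (rank-subst (flipSign σ) x y φ) (rank-subst σ x y ψ)
  rank-subst σ x y (φ ∧' ψ)   = cong₂ _⊔_ (rank-subst σ x y φ) (rank-subst σ x y ψ)
  rank-subst σ x y (φ ∨' ψ)   = cong₂ _⊔_ (rank-subst σ x y φ) (rank-subst σ x y ψ)
  rank-subst σ x y (qu Q z φ) with z ≟ x
  ... | yes _ = refl
  ... | no  _ = cong (headed σ (sign Q)) (rank-subst (sign Q) x y φ)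

  ▷-rank : ∀ {φ ψ} → φ ▷ ψ → ∀ σ → rank σ φ ≤ rank σ ψ
  ▷-rank (ex⇒ {ξ = ξ} {δ} _) σ =
    ≤-trans (≤-reflexive (cong (_⊔ rank σ δ) (headed-flip σ minus (rank plus ξ))))
            (headed-pullˡ σ minus (rank≤headed σ minus δ))
  ▷-rank (all⇒ {ξ = ξ} {δ} _) σ =
    ≤-trans (≤-reflexive (cong (_⊔ rank σ δ) (headed-flip σ plus (rank minus ξ))))
            (headed-pullˡ σ plus (rank≤headed σ plus δ))
  ▷-rank (⇒Q {Q} {δ = δ} _) σ = headed-pullʳ σ (sign Q) (rank-flip≤headed σ (sign Q) δ)
  ▷-rank (Q∧ {Q} {δ = δ} _) σ = headed-pullˡ σ (sign Q) (rank≤headed σ (sign Q) δ)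
  ▷-rank (∧Q {Q} {δ = δ} _) σ = headed-pullʳ σ (sign Q) (rank≤headed σ (sign Q) δ)
  ▷-rank (Q∨ {Q} {δ = δ} _) σ = headed-pullˡ σ (sign Q) (rank≤headed σ (sign Q) δ)
  ▷-rank (∨Q {Q} {δ = δ} _) σ = headed-pullʳ σ (sign Q) (rank≤headed σ (sign Q) δ)
  ▷-rank (rename {Q} {x} {y} {ξ} _) σ =
    ≤-reflexive (cong (headed σ (sign Q)) (sym (rank-subst (sign Q) x y ξ)))

  ⟶-rank : ∀ {φ ψ} → φ ⟶ ψ → ∀ σ → rank σ φ ≤ rank σ ψ
  ⟶-rank (root r)     σ = ▷-rank r σ
  ⟶-rank (⇒ˡ r)       σ = ⊔-monoˡ-≤ _ (⟶-rank r (flipSign σ))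
  ⟶-rank (⇒ʳ r)       σ = ⊔-monoʳ-≤ _ (⟶-rank r σ)
  ⟶-rank (∧ˡ r)       σ = ⊔-monoˡ-≤ _ (⟶-rank r σ)
  ⟶-rank (∧ʳ r)       σ = ⊔-monoʳ-≤ _ (⟶-rank r σ)
  ⟶-rank (∨ˡ r)       σ = ⊔-monoˡ-≤ _ (⟶-rank r σ)
  ⟶-rank (∨ʳ r)       σ = ⊔-monoʳ-≤ _ (⟶-rank r σ)
  ⟶-rank (qu {Q} r)   σ = headed-mono σ (sign Q) (⟶-rank r (sign Q))

  ▷*-rank : ∀ {φ ψ} → φ ▷* ψ → ∀ σ → rank σ φ ≤ rank σ ψ
  ▷*-rank φ▷*ψ σ = fold (λ φ ψ → rank σ φ ≤ rank σ ψ) (λ r → ≤-trans (⟶-rank r σ)) ≤-refl φ▷*ψ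

  QF⇒rank≡0 : ∀ σ {φ} → QF φ → rank σ φ ≡ 0
  QF⇒rank≡0 σ rel     = refl
  QF⇒rank≡0 σ ⊥'      = refl
  QF⇒rank≡0 σ (⇒ p q) = cong₂ _⊔_ (QF⇒rank≡0 (flipSign σ) p) (QF⇒rank≡0 σ q)
  QF⇒rank≡0 σ (∧ p q) = cong₂ _⊔_ (QF⇒rank≡0 σ p) (QF⇒rank≡0 σ q)
  QF⇒rank≡0 σ (∨ p q) = cong₂ _⊔_ (QF⇒rank≡0 σ p) (QF⇒rank≡0 σ q)

  quants-rank : ∀ Q xs {ψ k} → rank (sign Q) ψ ≤ suc k → rank (sign Q) (quants Q xs ψ) ≤ suc k
  quants-rank Q []       p = p
  quants-rank Q (x ∷ xs) p =
    ≤-trans (≤-reflexive (headed-self (sign Q) _)) (⊔-lub (quants-rank Q xs p) (s≤s z≤n))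

  Σₖ⇒rank≤ : ∀ k {φ} → Σₖ k φ → rank plus φ ≤ k
  Πₖ⇒rank≤ : ∀ k {φ} → Πₖ k φ → rank minus φ ≤ k
  Σₖ⇒rank≤ zero    q = ≤-reflexive (QF⇒rank≡0 plus q)
  Σₖ⇒rank≤ (suc k) (xs , ψ , _ , refl , ψ∈Πₖ) =
    quants-rank ex xs (≤-trans (rank-flip plus ψ) (s≤s (Πₖ⇒rank≤ k ψ∈Πₖ)))
  Πₖ⇒rank≤ zero    q = ≤-reflexive (QF⇒rank≡0 minus q)
  Πₖ⇒rank≤ (suc k) (xs , ψ , _ , refl , ψ∈Σₖ) =
    quants-rank all xs (≤-trans (rank-flip minus ψ) (s≤s (Σₖ⇒rank≤ k ψ∈Σₖ)))

  Σ⁺⇒rank≤ : ∀ k {φ} → Σ⁺ k φ → rank plus φ ≤ k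
  Σ⁺⇒rank≤ k     (inj₁ φ∈Σₖ)                   = Σₖ⇒rank≤ k φ∈Σₖ
  Σ⁺⇒rank≤ k     (inj₂ (j , j<k , inj₁ φ∈Σⱼ))  = ≤-trans (Σₖ⇒rank≤ j φ∈Σⱼ) (<⇒≤ j<k)
  Σ⁺⇒rank≤ k {φ} (inj₂ (j , j<k , inj₂ φ∈Πⱼ))  =
    ≤-trans (rank-flip plus φ) (≤-trans (s≤s (Πₖ⇒rank≤ j φ∈Πⱼ)) j<k)

  Π⁺⇒rank≤ : ∀ k {φ} → Π⁺ k φ → rank minus φ ≤ k
  Π⁺⇒rank≤ k     (inj₁ φ∈Πₖ)                   = Πₖ⇒rank≤ k φ∈Πₖ
  Π⁺⇒rank≤ k     (inj₂ (j , j<k , inj₂ φ∈Πⱼ))  = ≤-trans (Πₖ⇒rank≤ j φ∈Πⱼ) (<⇒≤ j<k)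
  Π⁺⇒rank≤ k {φ} (inj₂ (j , j<k , inj₁ φ∈Σⱼ))  =
    ≤-trans (rank-flip minus φ) (≤-trans (s≤s (Σₖ⇒rank≤ j φ∈Σⱼ)) j<k)

  Alt-pathRanks≤ : ∀ σ φ → PathRanks≤ σ (Alt φ) (rank σ φ)
  Alt-pathRanks≤ σ (rel r ts)   (here refl) = z≤n
  Alt-pathRanks≤ σ ⊥'           (here refl) = z≤n
  Alt-pathRanks≤ σ (φ ⇒ ψ)      =
    pathRanks≤-++ σ (pathRanks≤-^⊥ σ (Alt-pathRanks≤ (flipSign σ) φ)) (Alt-pathRanks≤ σ ψ)
  Alt-pathRanks≤ σ (φ ∧' ψ)     = pathRanks≤-++ σ (Alt-pathRanks≤ σ φ) (Alt-pathRanks≤ σ ψ)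
  Alt-pathRanks≤ σ (φ ∨' ψ)     = pathRanks≤-++ σ (Alt-pathRanks≤ σ φ) (Alt-pathRanks≤ σ ψ)
  Alt-pathRanks≤ σ (qu all x φ) = pathRanks≤-prefixSign σ minus (Alt-pathRanks≤ minus φ)
  Alt-pathRanks≤ σ (qu ex  x φ) = pathRanks≤-prefixSign σ plus (Alt-pathRanks≤ plus φ)

  deg≤rank : ∀ σ φ → deg φ ≤ rank σ φ
  deg≤rank σ φ = foldr-preservesᵇ {P = _≤ rank σ φ} ⊔-lub z≤n
    (map⁺ (tabulate λ s∈ → ≤-trans (length≤pathRank σ _) (Alt-pathRanks≤ σ φ s∈)))

  rank≤⇒longest-paths-start-with : ∀ σ k φ → rank σ φ ≤ suc k →
    ∀ s → s ∈ Alt φ → length s ≡ suc k → i s ≡ just σ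
  rank≤⇒longest-paths-start-with σ k φ p (τ ∷ s) s∈ refl =
    cong just (pathRank≤length⇒head σ τ s (≤-trans (Alt-pathRanks≤ σ φ s∈) p))

  rank≤⇒E⁺ : ∀ k φ → rank plus φ ≤ k → E⁺ k φ
  rank≤⇒E⁺ zero    φ p = inj₁ (n≤0⇒n≡0 (≤-trans (deg≤rank plus φ) p))
  rank≤⇒E⁺ (suc k) φ p with m≤n⇒m<n∨m≡n (≤-trans (deg≤rank plus φ) p)
  ... | inj₁ deg<k = inj₂ (deg φ , deg<k , refl)
  ... | inj₂ deg≡k = inj₁ (deg≡k , rank≤⇒longest-paths-start-with plus k φ p)

  rank≤⇒U⁺ : ∀ k φ → rank minus φ ≤ k → U⁺ k φ
  rank≤⇒U⁺ zero    φ p = inj₁ (n≤0⇒n≡0 (≤-trans (deg≤rank minus φ) p))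
  rank≤⇒U⁺ (suc k) φ p with m≤n⇒m<n∨m≡n (≤-trans (deg≤rank minus φ) p)
  ... | inj₁ deg<k = inj₂ (deg φ , deg<k , refl)
  ... | inj₂ deg≡k = inj₁ (deg≡k , rank≤⇒longest-paths-start-with minus k φ p)

theorem4p7 : (L : Language) → let open FOL L in
    (k : ℕ) (φ : Formula) →
      ((∃ λ ψ → ψ ∈PNF φ × Σ⁺ k ψ) → E⁺ k φ) ×
      ((∃ λ ψ → ψ ∈PNF φ × Π⁺ k ψ) → U⁺ k φ)
theorem4p7 L k φ =
  (λ (ψ , (φ▷*ψ , _) , ψ∈Σ⁺) → rank≤⇒E⁺ k φ (≤-trans (▷*-rank φ▷*ψ plus) (Σ⁺⇒rank≤ k ψ∈Σ⁺))) ,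
  (λ (ψ , (φ▷*ψ , _) , ψ∈Π⁺) → rank≤⇒U⁺ k φ (≤-trans (▷*-rank φ▷*ψ minus) (Π⁺⇒rank≤ k ψ∈Π⁺)))
  where open Rank L
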